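{- Let $\alpha:\omega\to\omega$ be a computable function and define $\alpha^*$ on $\omega$-mass problems by $(\alpha^*((\mathcal{A}_i)_{i\in\omega}))_n=\mathcal{A}_{\alpha(n)}$. Then $\alpha^*$ induces a well-defined function on $\mathcal{M}_\omega$ (i.e. $(\mathcal{A}_i)\le_{\mathcal{M}_\omega}(\mathcal{B}_i)$ implies $\alpha^*((\mathcal{A}_i))\le_{\mathcal{M}_\omega}\alpha^*((\mathcal{B}_i))$), and this function is a Brouwer algebra homomorphism $\mathcal{M}_\omega\to\mathcal{M}_\omega$.
   Context: An $\omega$-mass problem is a sequence $(\mathcal{A}_i)_{i\in\omega}$ of subsets of $\omega^\omega$. $(\mathcal{A}_i)\le_{\mathcal{M}_\omega}(\mathcal{B}_i)$ iff a single partial Turing functional $\Phi$ has $\Phi(n^\frown\mathcal{B}_n)\subseteq\mathcal{A}_n$ for all $n$, where $n^\frown f$ is the function with first value $n$ followed by $f$. $\mathcal{M}_\omega$ is the set of degrees; it is a Brouwer algebra under the componentwise operations $((\mathcal{A}_i)\oplus(\mathcal{B}_i))_n=\{f\oplus g:f\in\mathcal{A}_n,g\in\mathcal{B}_n\}$, $((\mathcal{A}_i)\otimes(\mathcal{B}_i))_n=0^\frown\mathcal{A}_n\cup1^\frown\mathcal{B}_n$, $((\mathcal{A}_i)\to(\mathcal{B}_i))_n=\{e^\frown f:\forall g\in\mathcal{A}_n\,(\Phi_e(g\oplus f)\in\mathcal{B}_n)\}$, where $(f\oplus g)(2k)=f(k)$, $(f\oplus g)(2k+1)=g(k)$ and $\Phi_e$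 is the $e$-th partial Turing functional. -}

module Defs where

open import Data.Nat using (ℕ; zero; suc; _+_)
open import Data.Product using (_×_; _,_; Σ; ∃; ∃-syntax; proj₁; proj₂)
open import Data.Sum using (_⊎_)
open import Data.Maybe using (Maybe; just; nothing; _>>=_)
open import Data.Unit using (⊤)
open import Data.Empty using (⊥)
open import Relation.Binary.PropositionalEquality using (_≡_)

Baire : Set
Baire = ℕ → ℕ

_⁀_ : ℕ → Baire → Baire
(n ⁀ f) zero = n
(n ⁀ f) (suc k) = f k

-- (f ⊕ g)(2k) = f k , (f ⊕ g)(2k+1) = g k
_⊕_ : Baire → Baire → Baire
(f ⊕ g) zero = f 0
(f ⊕ g) (suc zero) = g 0
(f ⊕ g) (suc (suc n)) = ((λ k → f (suc k)) ⊕ (λ k → g (suc k))) n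

_≈_ : Baire → Baire → Set
f ≈ g = ∀ k → f k ≡ g k

tri : ℕ → ℕ
tri zero = 0
tri (suc d) = suc d + tri d

pair : ℕ → ℕ → ℕ
pair x y = tri (x + y) + y

-- inverse of pair, by enumerating the diagonals
next : ℕ × ℕ → ℕ × ℕ
next (zero , y) = (suc y , 0)
next (suc x , y) = (x , suc y)

unpair : ℕ → ℕ × ℕ
unpair zero = (0 , 0)
unpair (suc n) = next (unpair n)

fst snd : ℕ → ℕ
fst n = proj₁ (unpair n)
snd n = proj₂ (unpair n)

-- Oracle computations: partial recursive functions ℕ ⇀ ℕ relative to
-- an oracle g : Baire, presented as unary combinators (using pairing).

data Code : Set where
  Z S I O L R : Code          -- 0, successor, identity, oracle g(x), fst, snd
  P C : Code → Code → Code    -- x ↦ pair (c x) (d x) ; composition c ∘ d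
  Rec : Code → Code → Code    -- f⟨x,0⟩ = c x ; f⟨x,y+1⟩ = d⟨x,⟨y,f⟨x,y⟩⟩⟩
  Mu : Code → Code            -- x ↦ least y with c⟨x,y⟩ = 0

mutual
  eval : ℕ → Code → Baire → ℕ → Maybe ℕ
  eval zero _ _ _ = nothing
  eval (suc s) Z g x = just 0
  eval (suc s) S g x = just (suc x)
  eval (suc s) I g x = just x
  eval (suc s) O g x = just (g x)
  eval (suc s) L g x = just (fst x)
  eval (suc s) R g x = just (snd x)
  eval (suc s) (P c d) g x =
    eval s c g x >>= λ a → eval s d g x >>= λ b → just (pair a b)
  eval (suc s) (C c d) g x = eval s d g x >>= λ a → eval s c g a
  eval (suc s) (Rec c d) g x = evalRec s c d g (fst x) (snd x)
  eval (suc s) (Mu c) g x = evalMu s c g x 0 s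

  evalRec : ℕ → Code → Code → Baire → ℕ → ℕ → Maybe ℕ
  evalRec s c d g a zero = eval s c g a
  evalRec s c d g a (suc y) =
    evalRec s c d g a y >>= λ r → eval s d g (pair a (pair y r))

  evalMu : ℕ → Code → Baire → ℕ → ℕ → ℕ → Maybe ℕ
  evalMu s c g x y zero = nothing
  evalMu s c g x y (suc k) = eval s c g (pair x y) >>= λ where
    zero → just y
    (suc _) → evalMu s c g x (suc y) k

Computes : Code → Baire → Baire → Set
Computes c g h = ∀ x → ∃[ s ] (eval s c g x ≡ just (h x))

-- α : ℕ → ℕ is computable (by an oracle-free computation; the oracle
-- supplied is the constant zero function, itself computable).
Computable : (ℕ → ℕ) → Set
Computable α = ∃[ c ] Computes c (λ _ → 0) α

-- Gödel numbering of codes: Φ_e = decode e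
decodeF : ℕ → ℕ → Code
decodeTag : ℕ → ℕ → ℕ → Code
decodeF zero _ = Z
decodeF (suc s) n = decodeTag s (fst n) (snd n)
decodeTag s 0 r = Z
decodeTag s 1 r = S
decodeTag s 2 r = I
decodeTag s 3 r = O
decodeTag s 4 r = L
decodeTag s 5 r = R
decodeTag s 6 r = P (decodeF s (fst r)) (decodeF s (snd r))
decodeTag s 7 r = C (decodeF s (fst r)) (decodeF s (snd r))
decodeTag s 8 r = Rec (decodeF s (fst r)) (decodeF s (snd r))
decodeTag s 9 r = Mu (decodeF s r)
decodeTag s _ r = Z

decode : ℕ → Code
decode e = decodeF (suc e) e

MassProblem : Set₁
MassProblem = Baire → Set

ωMass : Set₁
ωMass = ℕ → MassProblem

_≤M_ : ωMass → ωMass → Set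
A ≤M B = ∃[ Φ ] (∀ n f → B n f → ∃[ h ] (Computes Φ (n ⁀ f) h × A n h))

_≡M_ : ωMass → ωMass → Set
A ≡M B = (A ≤M B) × (B ≤M A)

_⊕M_ : ωMass → ωMass → ωMass
(A ⊕M B) n h = ∃[ f ] ∃[ g ] (A n f × B n g × h ≈ (f ⊕ g))

_⊗M_ : ωMass → ωMass → ωMass
(A ⊗M B) n h = (∃[ f ] (A n f × h ≈ (0 ⁀ f))) ⊎ (∃[ g ] (B n g × h ≈ (1 ⁀ g)))

_⇒M_ : ωMass → ωMass → ωMass
(A ⇒M B) n h = ∃[ e ] ∃[ f ] (h ≈ (e ⁀ f) ×
  (∀ g → A n g → ∃[ k ] (Computes (decode e) (g ⊕ f) k × B n k)))

⊥M : ωMass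
⊥M n f = ⊤

⊤M : ωMass
⊤M n f = ⊥

_* : (ℕ → ℕ) → ωMass → ωMass
(α *) A n = A (α n)

-- α* is monotone because a reduction Φ from oracles α(n)⁀f can be run on
-- oracles n⁀f: every oracle query is replaced by a subcomputation that answers
-- query 0 with α(n), computed from the oracle's first value n by an oracle-free
-- code for α, and answers query k > 0 by querying the oracle.  Since α* acts
-- by reindexing and all Brouwer operations act componentwise, α* commutes
-- with them on the nose.
module Submission where

open import Defs
open import Data.Nat using (ℕ; zero; suc; _+_; _≤_; s≤s; _⊔_)
open import Data.Nat.Properties
  using (+-identityʳ; +-suc; +-comm; ≤-refl; ≤-trans; m≤n+m; m⊔n≤o⇒m≤o; m⊔n≤o⇒n≤o)
open import Data.Product using (_×_; _,_; ∃-syntax; proj₁; proj₂)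
open import Data.Maybe using (just; _>>=_)
open import Relation.Binary.PropositionalEquality
  using (_≡_; refl; trans; cong; cong₂; module ≡-Reasoning)
open ≡-Reasoning

unpair-along-diagonal : ∀ n a b → unpair n ≡ (a + b , 0) → unpair (n + b) ≡ (a , b)
unpair-along-diagonal n a zero eq rewrite +-identityʳ n | +-identityʳ a = eq
unpair-along-diagonal n a (suc b) eq rewrite +-suc n b
  | unpair-along-diagonal n (suc a) b (trans eq (cong (_, 0) (+-suc a b))) = refl

unpair-tri : ∀ d → unpair (tri d) ≡ (d , 0)
unpair-tri zero = refl
unpair-tri (suc d)
  rewrite +-comm d (tri d) | unpair-along-diagonal (tri d) 0 d (unpair-tri d) = refl

unpair-pair : ∀ a b → unpair (pair a b) ≡ (a , b)
unpair-pair a b = unpair-along-diagonal (tri (a + b)) a b (unpair-tri (a + b))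

fst-pair : ∀ a b → fst (pair a b) ≡ a
fst-pair a b = cong proj₁ (unpair-pair a b)

snd-pair : ∀ a b → snd (pair a b) ≡ b
snd-pair a b = cong proj₂ (unpair-pair a b)

-- Convergence at all large fuels, rather than at some fuel, composes through
-- the simulation below without a monotonicity lemma for eval in the fuel.
Converges : Code → Baire → ℕ → ℕ → Set
Converges c g x v = ∃[ s ] (∀ t → s ≤ t → eval t c g x ≡ just v)

converges⇒computes : ∀ {c g h} → (∀ x → Converges c g x (h x)) → Computes c g h
converges⇒computes conv x = let s , eval≡ = conv x in s , eval≡ s ≤-refl

converges-at-fuel-1 : ∀ {c g x v} → (∀ t → eval (suc t) c g x ≡ just v) → Converges c g x v
converges-at-fuel-1 eval≡ = 1 , λ { (suc t) _ → eval≡ t }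

bind-just : ∀ {A B : Set} {m} {f : A → _} {a} {b : B} →
  m ≡ just a → f a ≡ just b → (m >>= f) ≡ just b
bind-just refl fa≡b = fa≡b

replaceOracle : Code → Code → Code
replaceOracle o Z = Z
replaceOracle o S = S
replaceOracle o I = I
replaceOracle o O = o
replaceOracle o L = L
replaceOracle o R = R
replaceOracle o (P c d) = P (replaceOracle o c) (replaceOracle o d)
replaceOracle o (C c d) = C (replaceOracle o c) (replaceOracle o d)
replaceOracle o (Rec c d) = Rec (replaceOracle o c) (replaceOracle o d)
replaceOracle o (Mu c) = Mu (replaceOracle o c)

module _ (o : Code) {g g' : Baire} (o-computes-g : ∀ x → Converges o g' x (g x)) where

  private
    T : Code → Code
    T = replaceOracle o

  mutual
    converges-replaceOracle : ∀ s c x {v} → eval s c g x ≡ just v → Converges (T c) g' x v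
    converges-replaceOracle (suc s) Z x refl = converges-at-fuel-1 λ _ → refl
    converges-replaceOracle (suc s) S x refl = converges-at-fuel-1 λ _ → refl
    converges-replaceOracle (suc s) I x refl = converges-at-fuel-1 λ _ → refl
    converges-replaceOracle (suc s) O x refl = o-computes-g x
    converges-replaceOracle (suc s) L x refl = converges-at-fuel-1 λ _ → refl
    converges-replaceOracle (suc s) R x refl = converges-at-fuel-1 λ _ → refl
    converges-replaceOracle (suc s) (P c d) x eval≡
      with eval s c g x in eval-c | eval s d g x in eval-d
    ... | just a | just b with refl ← eval≡
      with s₁ , conv-c ← converges-replaceOracle s c x eval-c
         | s₂ , conv-d ← converges-replaceOracle s d x eval-d
      = suc (s₁ ⊔ s₂) , λ { (suc t) (s≤s s₁⊔s₂≤t) →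
          bind-just (conv-c t (m⊔n≤o⇒m≤o s₁ s₂ s₁⊔s₂≤t))
            (bind-just (conv-d t (m⊔n≤o⇒n≤o s₁ s₂ s₁⊔s₂≤t)) refl) }
    converges-replaceOracle (suc s) (C c d) x eval≡ with eval s d g x in eval-d
    ... | just a
      with s₁ , conv-d ← converges-replaceOracle s d x eval-d
         | s₂ , conv-c ← converges-replaceOracle s c a eval≡
      = suc (s₁ ⊔ s₂) , λ { (suc t) (s≤s s₁⊔s₂≤t) →
          bind-just (conv-d t (m⊔n≤o⇒m≤o s₁ s₂ s₁⊔s₂≤t))
            (conv-c t (m⊔n≤o⇒n≤o s₁ s₂ s₁⊔s₂≤t)) }
    converges-replaceOracle (suc s) (Rec c d) x eval≡
      with s₁ , conv ← converges-replaceOracle-rec s c d (fst x) (snd x) eval≡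
      = suc s₁ , λ { (suc t) (s≤s s₁≤t) → conv t s₁≤t }
    converges-replaceOracle (suc s) (Mu c) x eval≡
      with s₁ , conv ← converges-replaceOracle-mu s c x 0 s eval≡
      = suc (s₁ ⊔ s) , λ { (suc t) (s≤s s₁⊔s≤t) →
          conv t (m⊔n≤o⇒m≤o s₁ s s₁⊔s≤t) t (m⊔n≤o⇒n≤o s₁ s s₁⊔s≤t) }

    converges-replaceOracle-rec : ∀ s c d a y {v} → evalRec s c d g a y ≡ just v →
      ∃[ s₀ ] (∀ t → s₀ ≤ t → evalRec t (T c) (T d) g' a y ≡ just v)
    converges-replaceOracle-rec s c d a zero eval≡ = converges-replaceOracle s c a eval≡
    converges-replaceOracle-rec s c d a (suc y) eval≡
      with evalRec s c d g a y in eval-y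
    ... | just r
      with s₁ , conv-y ← converges-replaceOracle-rec s c d a y eval-y
         | s₂ , conv-d ← converges-replaceOracle s d (pair a (pair y r)) eval≡
      = s₁ ⊔ s₂ , λ t s₁⊔s₂≤t →
          bind-just (conv-y t (m⊔n≤o⇒m≤o s₁ s₂ s₁⊔s₂≤t))
            (conv-d t (m⊔n≤o⇒n≤o s₁ s₂ s₁⊔s₂≤t))

    converges-replaceOracle-mu : ∀ s c x y k {v} → evalMu s c g x y k ≡ just v →
      ∃[ s₀ ] (∀ t → s₀ ≤ t → ∀ k' → k ≤ k' → evalMu t (T c) g' x y k' ≡ just v)
    converges-replaceOracle-mu s c x y (suc k) eval≡
      with eval s c g (pair x y) in eval-c
    ... | just zero with refl ← eval≡
      with s₁ , conv-c ← converges-replaceOracle s c (pair x y) eval-c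
      = s₁ , λ { t s₁≤t (suc k') _ → bind-just (conv-c t s₁≤t) refl }
    ... | just (suc _)
      with s₁ , conv-c ← converges-replaceOracle s c (pair x y) eval-c
         | s₂ , conv-mu ← converges-replaceOracle-mu s c x (suc y) k eval≡
      = s₁ ⊔ s₂ , λ { t s₁⊔s₂≤t (suc k') (s≤s k≤k') →
          bind-just (conv-c t (m⊔n≤o⇒m≤o s₁ s₂ s₁⊔s₂≤t))
            (conv-mu t (m⊔n≤o⇒n≤o s₁ s₂ s₁⊔s₂≤t) k' k≤k') }

-- The case distinction x = 0 / x > 0 is made by primitive recursion on y
-- evaluated at ⟨x , x⟩: the base case is a(g 0), every step queries g x.
replaceHead : Code → Code
replaceHead a = C (Rec (C a (C O Z)) (C O L)) (P I I)

module _ (a : Code) (g : Baire) (m : ℕ) where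

  evalRec-replaceHead : ∀ u → eval (2 + u) a g (g 0) ≡ just m → ∀ x y →
    evalRec (3 + u) (C a (C O Z)) (C O L) g x y ≡ just ((m ⁀ λ _ → g x) y)
  evalRec-replaceHead u a-at-head x zero = a-at-head
  evalRec-replaceHead u a-at-head x (suc y) =
    bind-just (evalRec-replaceHead u a-at-head x y) (cong (λ z → just (g z)) (fst-pair x _))

  converges-replaceHead : Converges a g (g 0) m →
    ∀ x → Converges (replaceHead a) g x ((m ⁀ λ k → g (suc k)) x)
  converges-replaceHead (s , conv-a) x = 5 + s , λ
    { (suc (suc (suc (suc (suc u))))) (s≤s (s≤s (s≤s (s≤s (s≤s s≤u))))) →
    begin
      evalRec (3 + u) (C a (C O Z)) (C O L) g (fst (pair x x)) (snd (pair x x))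
    ≡⟨ cong₂ (evalRec (3 + u) (C a (C O Z)) (C O L) g) (fst-pair x x) (snd-pair x x) ⟩
      evalRec (3 + u) (C a (C O Z)) (C O L) g x x
    ≡⟨ evalRec-replaceHead u (conv-a (2 + u) (≤-trans s≤u (m≤n+m u 2))) x x ⟩
      just ((m ⁀ λ _ → g x) x)
    ≡⟨ cong just (diagonal x) ⟩
      just ((m ⁀ λ k → g (suc k)) x)
    ∎ }
    where
    diagonal : ∀ x → (m ⁀ λ _ → g x) x ≡ (m ⁀ λ k → g (suc k)) x
    diagonal zero = refl
    diagonal (suc x) = refl

computes-replaceOracle : ∀ {o g g' c h} → (∀ x → Converges o g' x (g x)) →
  Computes c g h → Computes (replaceOracle o c) g' h
computes-replaceOracle {o} {c = c} o-computes-g c-computes =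
  converges⇒computes λ x →
    let s , eval≡ = c-computes x in converges-replaceOracle o o-computes-g s c x eval≡

converges-oracleFree : ∀ {c h} → Computes c (λ _ → 0) h →
  ∀ g x → Converges (replaceOracle Z c) g x (h x)
converges-oracleFree {c} c-computes g x =
  let s , eval≡ = c-computes x in
  converges-replaceOracle Z (λ _ → converges-at-fuel-1 λ _ → refl) s c x eval≡

*-mono : ∀ {α} → Computable α → ∀ A B → A ≤M B → (α *) A ≤M (α *) B
*-mono {α} (c , c-computes) A B (Φ , reduce) =
  replaceOracle (replaceHead (replaceOracle Z c)) Φ , λ n f Bf →
    let h , Φ-computes , Ah = reduce (α n) f Bf
        head-computes = converges-replaceHead (replaceOracle Z c) (n ⁀ f) (α n)
                          (converges-oracleFree c-computes (n ⁀ f) n)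
    in h , computes-replaceOracle head-computes Φ-computes , Ah

≤M-refl : ∀ A → A ≤M A
≤M-refl A = C O S , λ n f Af → f , (λ _ → 2 , refl) , Af

≡M-refl : ∀ A → A ≡M A
≡M-refl A = ≤M-refl A , ≤M-refl A

proposition4p2 : (α : ℕ → ℕ) → Computable α →
    ((A B : ωMass) → A ≤M B → (α *) A ≤M (α *) B)
    × ((A B : ωMass) → (α *) (A ⊕M B) ≡M ((α *) A ⊕M (α *) B))
    × ((A B : ωMass) → (α *) (A ⊗M B) ≡M ((α *) A ⊗M (α *) B))
    × ((A B : ωMass) → (α *) (A ⇒M B) ≡M ((α *) A ⇒M (α *) B))
    × ((α *) ⊥M ≡M ⊥M)
    × ((α *) ⊤M ≡M ⊤M)
proposition4p2 α α-computable =
  *-mono α-computable ,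
  (λ A B → ≡M-refl _) ,
  (λ A B → ≡M-refl _) ,
  (λ A B → ≡M-refl _) ,
  ≡M-refl _ ,
  ≡M-refl _
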